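{- For every ordinal $\alpha$ with $0<\alpha<\varepsilon_0$ and every $x\in\mathbb N$, $A_\alpha(x)\le F_\alpha(x)\le A_\alpha(6x+5)$.
   Context: Ordinals are below $\varepsilon_0$ in Cantor normal form; limit ordinals have fundamental sequences $(\gamma+\omega^{\beta+1})(x)=\gamma+\omega^\beta\cdot(x+1)$, $(\gamma+\omega^{\lambda'})(x)=\gamma+\omega^{\lambda'(x)}$ for $\lambda'$ limit. Fast-growing functions: $F_0(x)=x+1$, $F_{\alpha+1}(x)=F_\alpha^{x+1}(x)$, $F_\lambda(x)=F_{\lambda(x)}(x)$. Ackermann functions for $\alpha>0$: $A_1(x)=2x$, $A_{\alpha+1}(x)=A_\alpha^x(1)$ ($x$-fold iterate), $A_\lambda(x)=A_{\lambda(x)}(x)$. -}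

module Defs where

open import Data.Nat using (ℕ; zero; suc; _*_; _≤_)
open import Data.Bool using (Bool; true; false; if_then_else_)
open import Data.Sum using (_⊎_)
open import Data.Product using (∃; _×_)
open import Relation.Binary.PropositionalEquality using (_≡_; _≢_)

-- Ordinals below ε₀ in Cantor normal form.
-- ω^ a + b  denotes  ω^a + b ; a term is in normal form (IsNF) when
-- the exponents are weakly decreasing from left to right.

data Ord : Set where
  𝟎    : Ord
  ω^_+_ : Ord → Ord → Ord

infixr 30 ω^_+_
infix 4 _<ₒ_ _≤ₒ_

data _<ₒ_ : Ord → Ord → Set where
  0<ω  : ∀ {a b} → 𝟎 <ₒ ω^ a + b
  exp< : ∀ {a b c d} → a <ₒ c → ω^ a + b <ₒ ω^ c + d
  tail< : ∀ {a b d} → b <ₒ d → ω^ a + b <ₒ ω^ a + d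

_≤ₒ_ : Ord → Ord → Set
a ≤ₒ b = a <ₒ b ⊎ a ≡ b

data LeadingExp≤ : Ord → Ord → Set where
  lead-𝟎 : ∀ {a} → LeadingExp≤ 𝟎 a
  lead-ω : ∀ {a c d} → c ≤ₒ a → LeadingExp≤ (ω^ c + d) a

data IsNF : Ord → Set where
  nf-𝟎 : IsNF 𝟎
  nf-ω : ∀ {a b} → IsNF a → IsNF b → LeadingExp≤ b a → IsNF (ω^ a + b)

𝟏 : Ord
𝟏 = ω^ 𝟎 + 𝟎

isSucc : Ord → Bool
isSucc 𝟎 = false
isSucc (ω^ 𝟎 + 𝟎) = true
isSucc (ω^ (ω^ _ + _) + 𝟎) = false
isSucc (ω^ a + (ω^ c + d)) = isSucc (ω^ c + d)

pred : Ord → Ord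
pred 𝟎 = 𝟎
pred (ω^ a + 𝟎) = 𝟎
pred (ω^ a + (ω^ c + d)) = ω^ a + pred (ω^ c + d)

ω^_·_ : Ord → ℕ → Ord
ω^ b · zero = 𝟎
ω^ b · suc n = ω^ b + (ω^ b · n)

IsLimit : Ord → Set
IsLimit α = (α ≢ 𝟎) × (isSucc α ≡ false)

mutual
  -- fundamental sequence λ(x) (only meaningful for limit λ)
  _[_] : Ord → ℕ → Ord
  𝟎 [ x ] = 𝟎
  (ω^ a + 𝟎) [ x ] = ωfs a x
  (ω^ a + (ω^ c + d)) [ x ] = ω^ a + ((ω^ c + d) [ x ])

  ωfs : Ord → ℕ → Ord
  ωfs a x = if isSucc a then ω^ (pred a) · suc x else ω^ (a [ x ]) + 𝟎

data Iter (R : ℕ → ℕ → Set) : ℕ → ℕ → ℕ → Set where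
  it-zero : ∀ {x} → Iter R zero x x
  it-suc  : ∀ {n x z y} → R x z → Iter R n z y → Iter R (suc n) x y

-- Fast-growing hierarchy, as the graph  F α x y  ⇔  F_α(x) = y
--   F_0(x) = x+1,  F_{α+1}(x) = F_α^{x+1}(x),  F_λ(x) = F_{λ(x)}(x)

data F : Ord → ℕ → ℕ → Set where
  F-zero : ∀ {x} → F 𝟎 x (suc x)
  F-suc  : ∀ {α x y} → isSucc α ≡ true → Iter (F (pred α)) (suc x) x y → F α x y
  F-lim  : ∀ {α x y} → IsLimit α → F (α [ x ]) x y → F α x y

-- Ackermann functions (α > 0), as the graph  A α x y  ⇔  A_α(x) = y
--   A_1(x) = 2x,  A_{α+1}(x) = A_α^x(1),  A_λ(x) = A_{λ(x)}(x)

data A : Ord → ℕ → ℕ → Set where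
  A-one : ∀ {x} → A 𝟏 x (2 * x)
  A-suc : ∀ {α x y} → isSucc α ≡ true → pred α ≢ 𝟎 → Iter (A (pred α)) x 1 y → A α x y
  A-lim : ∀ {α x y} → IsLimit α → A (α [ x ]) x y → A α x y

-- Both bounds are proved by induction along the recursion defining F and A: pred at
-- successors and fundamental sequences at limits, which is well founded on normal forms.
-- The limit cases rest on monotonicity of both hierarchies in the argument and in the
-- ordinal along the descents α ⇝ pred α and λ ⇝ λ[0], since λ[k+1] ⇝* λ[k]. At a
-- successor α = p + 1 the lower bound is A_p^x(1) ≤ F_p^x(F_p(x)) = F_α(x), iterating the
-- hypothesis A_p ≤ F_p; for the upper bound, each F_p-step is dominated by five A_p-steps,
-- four of which multiply by at least 16, so F_p^(x+1)(x) ≤ A_p^(x+5(x+1))(1) = A_α(6x+5).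
module Submission where

open import Defs
open import Data.Bool using (true; false)
open import Data.Empty using (⊥-elim)
open import Data.Nat using (ℕ; zero; suc; _+_; _*_; _^_; _≤_; _<_; _≤′_; z≤n; s≤s; ≤′-refl; ≤′-step)
open import Data.Nat.Properties
open import Data.Nat.Tactic.RingSolver using (solve-∀)
open import Data.Product using (Σ; ∃; _×_; _,_; proj₁; proj₂; map₂)
open import Data.Sum using (_⊎_; inj₁; inj₂)
open import Induction.WellFounded using (Acc; acc)
open import Relation.Binary.Construct.Closure.ReflexiveTransitive using (Star; ε; _◅_; _◅◅_; gmap)
open import Relation.Binary.PropositionalEquality using (_≡_; _≢_; refl; sym; trans; cong; subst)
open import Relation.Nullary using (¬_)

-- Cantor normal forms: predecessor and fundamental sequences

data Shape : Ord → Set where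
  zero  : Shape 𝟎
  succ  : ∀ {α} → isSucc α ≡ true → Shape α
  limit : ∀ {α} → IsLimit α → Shape α

shape : ∀ α → Shape α
shape 𝟎 = zero
shape α@(ω^ _ + _) with isSucc α in eq
... | true  = succ eq
... | false = limit ((λ ()) , eq)

succ⇒¬limit : ∀ {α} → isSucc α ≡ true → ¬ IsLimit α
succ⇒¬limit s (_ , l) with trans (sym s) l
... | ()

succ⇒≢𝟎 : ∀ {α} → isSucc α ≡ true → α ≢ 𝟎
succ⇒≢𝟎 () refl

isSucc-+ : ∀ a {β} → β ≢ 𝟎 → isSucc (ω^ a + β) ≡ isSucc β
isSucc-+ a {𝟎} β≢𝟎 = ⊥-elim (β≢𝟎 refl)
isSucc-+ 𝟎 {ω^ _ + _} _ = refl
isSucc-+ (ω^ _ + _) {ω^ _ + _} _ = refl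

pred-+ : ∀ a {β} → β ≢ 𝟎 → pred (ω^ a + β) ≡ ω^ a + pred β
pred-+ a {𝟎} β≢𝟎 = ⊥-elim (β≢𝟎 refl)
pred-+ a {ω^ _ + _} _ = refl

fs-+ : ∀ a {β} x → β ≢ 𝟎 → (ω^ a + β) [ x ] ≡ ω^ a + (β [ x ])
fs-+ a {𝟎} x β≢𝟎 = ⊥-elim (β≢𝟎 refl)
fs-+ a {ω^ _ + _} x _ = refl

limit-+ : ∀ {a β} → β ≢ 𝟎 → IsLimit (ω^ a + β) → IsLimit β
limit-+ {a} β≢𝟎 (_ , l) = β≢𝟎 , trans (sym (isSucc-+ a β≢𝟎)) l

ω^-limit : ∀ {e} → e ≢ 𝟎 → IsLimit (ω^ e + 𝟎)
ω^-limit {𝟎} e≢𝟎 = ⊥-elim (e≢𝟎 refl)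
ω^-limit {ω^ _ + _} _ = (λ ()) , refl

limit-ω^ : ∀ {e} → IsLimit (ω^ e + 𝟎) → e ≢ 𝟎
limit-ω^ (_ , ()) refl

ω^-fs-succ : ∀ {e} x → isSucc e ≡ true → (ω^ e + 𝟎) [ x ] ≡ ω^ pred e · suc x
ω^-fs-succ x s rewrite s = refl

ω^-fs-limit : ∀ {e} x → isSucc e ≡ false → (ω^ e + 𝟎) [ x ] ≡ ω^ (e [ x ]) + 𝟎
ω^-fs-limit x l rewrite l = refl

≡𝟎⊎≢𝟎 : ∀ β → β ≡ 𝟎 ⊎ β ≢ 𝟎
≡𝟎⊎≢𝟎 𝟎 = inj₁ refl
≡𝟎⊎≢𝟎 (ω^ _ + _) = inj₂ λ ()

pred≡𝟎⇒≡𝟏 : ∀ {α} → isSucc α ≡ true → pred α ≡ 𝟎 → α ≡ 𝟏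
pred≡𝟎⇒≡𝟏 {ω^ 𝟎 + 𝟎} _ _ = refl
pred≡𝟎⇒≡𝟏 {ω^ (ω^ _ + _) + 𝟎} () _
pred≡𝟎⇒≡𝟏 {ω^ _ + (ω^ _ + _)} _ ()

fs-≢𝟎 : ∀ {α} x → IsLimit α → α [ x ] ≢ 𝟎
fs-≢𝟎 {𝟎} _ l = ⊥-elim (proj₁ l refl)
fs-≢𝟎 {ω^ a + 𝟎} _ _ with isSucc a
... | true  = λ ()
... | false = λ ()
fs-≢𝟎 {ω^ _ + (ω^ _ + _)} _ _ = λ ()

pred-<ₒ : ∀ {α} → isSucc α ≡ true → pred α <ₒ α
pred-<ₒ {ω^ _ + 𝟎} _ = 0<ω
pred-<ₒ {ω^ a + β@(ω^ _ + _)} s = tail< (pred-<ₒ (trans (sym (isSucc-+ a {β} (λ ()))) s))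

fs-<ₒ : ∀ {α} x → IsLimit α → α [ x ] <ₒ α
fs-<ₒ {𝟎} x l = ⊥-elim (proj₁ l refl)
fs-<ₒ {ω^ a + 𝟎} x l with isSucc a in eq
... | true  = exp< (pred-<ₒ eq)
... | false = exp< (fs-<ₒ x (limit-ω^ l , eq))
fs-<ₒ {ω^ _ + (ω^ _ + _)} x l = tail< (fs-<ₒ x (limit-+ (λ ()) l))

<ₒ-≤ₒ-trans : ∀ {a b c} → a <ₒ b → b ≤ₒ c → a <ₒ c
<ₒ-≤ₒ-trans a<b (inj₂ refl) = a<b
<ₒ-≤ₒ-trans 0<ω (inj₁ (exp< _)) = 0<ω
<ₒ-≤ₒ-trans 0<ω (inj₁ (tail< _)) = 0<ω
<ₒ-≤ₒ-trans (exp< p) (inj₁ (exp< q)) = exp< (<ₒ-≤ₒ-trans p (inj₁ q))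
<ₒ-≤ₒ-trans (exp< p) (inj₁ (tail< _)) = exp< p
<ₒ-≤ₒ-trans (tail< _) (inj₁ (exp< q)) = exp< q
<ₒ-≤ₒ-trans (tail< p) (inj₁ (tail< q)) = tail< (<ₒ-≤ₒ-trans p (inj₁ q))

pred-lead : ∀ {d a} → LeadingExp≤ d a → LeadingExp≤ (pred d) a
pred-lead lead-𝟎 = lead-𝟎
pred-lead {ω^ _ + 𝟎} (lead-ω _) = lead-𝟎
pred-lead {ω^ _ + (ω^ _ + _)} (lead-ω c≤a) = lead-ω c≤a

pred-nf : ∀ {α} → IsNF α → IsNF (pred α)
pred-nf nf-𝟎 = nf-𝟎
pred-nf {ω^ _ + 𝟎} (nf-ω _ _ _) = nf-𝟎
pred-nf {ω^ _ + (ω^ _ + _)} (nf-ω na nb lb) = nf-ω na (pred-nf nb) (pred-lead lb)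

ω^·-lead : ∀ {a c} n → c ≤ₒ a → LeadingExp≤ (ω^ c · n) a
ω^·-lead zero _ = lead-𝟎
ω^·-lead (suc n) c≤a = lead-ω c≤a

ω^·-nf : ∀ {c} n → IsNF c → IsNF (ω^ c · n)
ω^·-nf zero _ = nf-𝟎
ω^·-nf (suc n) nc = nf-ω nc (ω^·-nf n nc) (ω^·-lead n (inj₂ refl))

fs-lead : ∀ {b a} x → IsLimit b → LeadingExp≤ b a → LeadingExp≤ (b [ x ]) a
fs-lead {𝟎} _ _ _ = lead-𝟎
fs-lead {ω^ c + 𝟎} x l (lead-ω c≤a) with isSucc c in eq
... | true  = ω^·-lead (suc x) (inj₁ (<ₒ-≤ₒ-trans (pred-<ₒ eq) c≤a))
... | false = lead-ω (inj₁ (<ₒ-≤ₒ-trans (fs-<ₒ x (limit-ω^ l , eq)) c≤a))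
fs-lead {ω^ _ + (ω^ _ + _)} _ _ (lead-ω c≤a) = lead-ω c≤a

fs-nf : ∀ {α} x → IsNF α → IsLimit α → IsNF (α [ x ])
fs-nf x nf-𝟎 _ = nf-𝟎
fs-nf {ω^ a + 𝟎} x (nf-ω na _ _) l with isSucc a in eq
... | true  = ω^·-nf (suc x) (pred-nf na)
... | false = nf-ω (fs-nf x na (limit-ω^ l , eq)) nf-𝟎 lead-𝟎
fs-nf {ω^ _ + (ω^ _ + _)} x (nf-ω na nb lb) l =
  nf-ω na (fs-nf x nb (limit-+ (λ ()) l)) (fs-lead x (limit-+ (λ ()) l) lb)

-- Well-founded recursion on normal forms

_⊏_ : Ord → Ord → Set
β ⊏ α = IsNF β × β <ₒ α

𝟎-acc : Acc _⊏_ 𝟎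
𝟎-acc = acc λ { (_ , ()) }

mutual
  lead≤-acc : ∀ {a b} → Acc _⊏_ a → IsNF b → LeadingExp≤ b a → Acc _⊏_ b
  lead≤-acc _ nf-𝟎 _ = 𝟎-acc
  lead≤-acc (acc rs) (nf-ω nc nd ld) (lead-ω (inj₁ c<a)) =
    ω^-acc (rs (nc , c<a)) (lead≤-acc (rs (nc , c<a)) nd ld)
  lead≤-acc acc-a (nf-ω _ nd ld) (lead-ω (inj₂ refl)) = ω^-acc acc-a (lead≤-acc acc-a nd ld)

  ω^-acc : ∀ {a d} → Acc _⊏_ a → Acc _⊏_ d → Acc _⊏_ (ω^ a + d)
  ω^-acc {a} {d} acc-a (acc rd) = acc (below acc-a)
    where
    below : Acc _⊏_ a → ∀ {z} → z ⊏ ω^ a + d → Acc _⊏_ z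
    below _ (_ , 0<ω) = 𝟎-acc
    below (acc rs) (nz@(nf-ω nc _ _) , exp< c<a) = lead≤-acc (rs (nc , c<a)) nz (lead-ω (inj₂ refl))
    below acc-a′ (nf-ω _ nd′ _ , tail< d′<d) = ω^-acc acc-a′ (rd (nd′ , d′<d))

⊏-acc : ∀ {α} → IsNF α → Acc _⊏_ α
⊏-acc nf-𝟎 = 𝟎-acc
⊏-acc nα@(nf-ω na _ _) = lead≤-acc (⊏-acc na) nα (lead-ω (inj₂ refl))

module _ {P : Ord → Set}
  (P-𝟎 : P 𝟎)
  (P-suc : ∀ {α} → IsNF α → isSucc α ≡ true → P (pred α) → P α)
  (P-lim : ∀ {α} → IsNF α → IsLimit α → (∀ x → P (α [ x ])) → P α)
  where

  nf-rec : ∀ {α} → IsNF α → P α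
  nf-rec nα = go nα (⊏-acc nα)
    where
    go : ∀ {α} → IsNF α → Acc _⊏_ α → P α
    go {α} nα (acc rs) with shape α
    ... | zero    = P-𝟎
    ... | succ s  = P-suc nα s (go (pred-nf nα) (rs (pred-nf nα , pred-<ₒ s)))
    ... | limit l = P-lim nα l λ x → go (fs-nf x nα l) (rs (fs-nf x nα l , fs-<ₒ x l))

module _ {P : Ord → Set}
  (P-𝟏 : P 𝟏)
  (P-suc : ∀ {α} → IsNF α → isSucc α ≡ true → pred α ≢ 𝟎 → P (pred α) → P α)
  (P-lim : ∀ {α} → IsNF α → IsLimit α → (∀ x → P (α [ x ])) → P α)
  where

  nf-rec⁺ : ∀ {α} → IsNF α → α ≢ 𝟎 → P α
  nf-rec⁺ = nf-rec {P = λ α → α ≢ 𝟎 → P α} (λ 𝟎≢𝟎 → ⊥-elim (𝟎≢𝟎 refl)) suc-case lim-case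
    where
    suc-case : ∀ {α} → IsNF α → isSucc α ≡ true → (pred α ≢ 𝟎 → P (pred α)) → α ≢ 𝟎 → P α
    suc-case {α} nα s ih _ with ≡𝟎⊎≢𝟎 (pred α)
    ... | inj₁ p≡𝟎 = subst P (sym (pred≡𝟎⇒≡𝟏 s p≡𝟎)) P-𝟏
    ... | inj₂ p≢𝟎 = P-suc nα s p≢𝟎 (ih p≢𝟎)
    lim-case : ∀ {α} → IsNF α → IsLimit α → (∀ x → α [ x ] ≢ 𝟎 → P (α [ x ])) → α ≢ 𝟎 → P α
    lim-case nα l ih _ = P-lim nα l λ x → ih x (fs-≢𝟎 x l)

-- Descent along predecessors and fundamental sequences

infix 4 _⇝_ _⇝*_

data _⇝_ : Ord → Ord → Set where
  pred-step : ∀ {α} → isSucc α ≡ true → α ⇝ pred α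
  fs-step   : ∀ {α} → IsLimit α → α ⇝ α [ 0 ]

_⇝*_ : Ord → Ord → Set
_⇝*_ = Star _⇝_

𝟎-⇝* : ∀ {β} → 𝟎 ⇝* β → β ≡ 𝟎
𝟎-⇝* ε = refl
𝟎-⇝* (fs-step l ◅ _) = ⊥-elim (proj₁ l refl)

nf-⇝*𝟎 : ∀ {α} → IsNF α → α ⇝* 𝟎
nf-⇝*𝟎 = nf-rec {P = _⇝* 𝟎} ε (λ _ s r → pred-step s ◅ r) (λ _ l r → fs-step l ◅ r 0)

ω^-⇝ : ∀ {e e′} → e ⇝ e′ → ω^ e + 𝟎 ⇝ ω^ e′ + 𝟎
ω^-⇝ {e} (pred-step s) = subst (ω^ e + 𝟎 ⇝_) (ω^-fs-succ 0 s) (fs-step (ω^-limit (succ⇒≢𝟎 s)))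
ω^-⇝ {e} (fs-step l) = subst (ω^ e + 𝟎 ⇝_) (ω^-fs-limit 0 (proj₂ l)) (fs-step (ω^-limit (proj₁ l)))

ω^-⇝* : ∀ {e e′} → e ⇝* e′ → ω^ e + 𝟎 ⇝* ω^ e′ + 𝟎
ω^-⇝* = gmap (λ e → ω^ e + 𝟎) ω^-⇝

infixr 15 _⊕_
_⊕_ : Ord → Ord → Ord
𝟎 ⊕ δ = δ
(ω^ a + b) ⊕ δ = ω^ a + (b ⊕ δ)

⊕-identityʳ : ∀ γ → γ ⊕ 𝟎 ≡ γ
⊕-identityʳ 𝟎 = refl
⊕-identityʳ (ω^ a + b) = cong (ω^ a +_) (⊕-identityʳ b)

⊕-≢𝟎 : ∀ γ {δ} → δ ≢ 𝟎 → γ ⊕ δ ≢ 𝟎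
⊕-≢𝟎 𝟎 δ≢𝟎 = δ≢𝟎
⊕-≢𝟎 (ω^ _ + _) _ = λ ()

isSucc-⊕ : ∀ γ {δ} → δ ≢ 𝟎 → isSucc (γ ⊕ δ) ≡ isSucc δ
isSucc-⊕ 𝟎 _ = refl
isSucc-⊕ (ω^ a + b) δ≢𝟎 = trans (isSucc-+ a (⊕-≢𝟎 b δ≢𝟎)) (isSucc-⊕ b δ≢𝟎)

pred-⊕ : ∀ γ {δ} → δ ≢ 𝟎 → pred (γ ⊕ δ) ≡ γ ⊕ pred δ
pred-⊕ 𝟎 _ = refl
pred-⊕ (ω^ a + b) δ≢𝟎 = trans (pred-+ a (⊕-≢𝟎 b δ≢𝟎)) (cong (ω^ a +_) (pred-⊕ b δ≢𝟎))

fs-⊕ : ∀ γ {δ} x → δ ≢ 𝟎 → (γ ⊕ δ) [ x ] ≡ γ ⊕ δ [ x ]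
fs-⊕ 𝟎 _ _ = refl
fs-⊕ (ω^ a + b) x δ≢𝟎 = trans (fs-+ a x (⊕-≢𝟎 b δ≢𝟎)) (cong (ω^ a +_) (fs-⊕ b x δ≢𝟎))

⊕-⇝ : ∀ γ {α β} → α ⇝ β → γ ⊕ α ⇝ γ ⊕ β
⊕-⇝ γ {α} (pred-step s) =
  subst (γ ⊕ α ⇝_) (pred-⊕ γ (succ⇒≢𝟎 s)) (pred-step (trans (isSucc-⊕ γ (succ⇒≢𝟎 s)) s))
⊕-⇝ γ {α} (fs-step (α≢𝟎 , l)) =
  subst (γ ⊕ α ⇝_) (fs-⊕ γ 0 α≢𝟎) (fs-step (⊕-≢𝟎 γ α≢𝟎 , trans (isSucc-⊕ γ α≢𝟎) l))

⊕-⇝* : ∀ γ {α β} → α ⇝* β → γ ⊕ α ⇝* γ ⊕ β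
⊕-⇝* γ = gmap (γ ⊕_) (⊕-⇝ γ)

⊕-ω^-⇝* : ∀ γ {e} → IsNF e → γ ⊕ ω^ e + 𝟎 ⇝* γ
⊕-ω^-⇝* γ ne =
  subst (γ ⊕ _ ⇝*_) (⊕-identityʳ γ) (⊕-⇝* γ (ω^-⇝* (nf-⇝*𝟎 ne) ◅◅ pred-step refl ◅ ε))

ω^·-suc : ∀ c n → ω^ c · suc n ≡ ω^ c · n ⊕ ω^ c + 𝟎
ω^·-suc c zero = refl
ω^·-suc c (suc n) = cong (ω^ c +_) (ω^·-suc c n)

fs-suc-⇝* : ∀ {λ′} k → IsNF λ′ → IsLimit λ′ → λ′ [ suc k ] ⇝* λ′ [ k ]
fs-suc-⇝* {𝟎} _ _ l = ⊥-elim (proj₁ l refl)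
fs-suc-⇝* {ω^ a + 𝟎} k (nf-ω na _ _) l with isSucc a in eq
... | true  = subst (_⇝* ω^ pred a · suc k) (sym (ω^·-suc (pred a) (suc k))) (⊕-ω^-⇝* _ (pred-nf na))
... | false = ω^-⇝* (fs-suc-⇝* k na (limit-ω^ l , eq))
fs-suc-⇝* {ω^ a + (ω^ _ + _)} k (nf-ω _ nb _) l = ⊕-⇝* (ω^ a + 𝟎) (fs-suc-⇝* k nb (limit-+ (λ ()) l))

fs-⇝* : ∀ {λ′ k n} → IsNF λ′ → IsLimit λ′ → k ≤ n → λ′ [ n ] ⇝* λ′ [ k ]
fs-⇝* {λ′} {k} nλ l k≤n = go (≤⇒≤′ k≤n)
  where
  go : ∀ {n} → k ≤′ n → λ′ [ n ] ⇝* λ′ [ k ]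
  go ≤′-refl = ε
  go (≤′-step {n} k≤n) = fs-suc-⇝* n nλ l ◅◅ go k≤n

-- Iterated graphs

-- For graphs of functions f and g, R ≤ᵍ S says that f x ≤ g y whenever x ≤ y;
-- so R ≤ᵍ R is monotonicity of f.
infix 4 _≤ᵍ_
_≤ᵍ_ : (R S : ℕ → ℕ → Set) → Set
R ≤ᵍ S = ∀ {x y u v} → x ≤ y → R x u → S y v → u ≤ v

Inflationary : (ℕ → ℕ → Set) → Set
Inflationary R = ∀ {z w} → R z w → z ≤ w

Doubling : (ℕ → ℕ → Set) → Set
Doubling R = ∀ {z w} → R z w → 2 * z ≤ w

≤ᵍ-trans : ∀ {R S T : ℕ → ℕ → Set} → (∀ z → ∃ (S z)) → R ≤ᵍ S → S ≤ᵍ T → R ≤ᵍ T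
≤ᵍ-trans S-total R≤S S≤T {x} x≤y r t =
  let (_ , s) = S-total x in ≤-trans (R≤S ≤-refl r s) (S≤T x≤y s t)

module _ {R : ℕ → ℕ → Set} where

  Iter-total : (∀ z → ∃ (R z)) → ∀ n s → ∃ (Iter R n s)
  Iter-total _ zero s = s , it-zero
  Iter-total R-total (suc n) s =
    let (z , r) = R-total s; (y , it) = Iter-total R-total n z in y , it-suc r it

  Iter-snoc : ∀ {n s y} → Iter R (suc n) s y → ∃ λ z → Iter R n s z × R z y
  Iter-snoc (it-suc r it-zero) = _ , it-zero , r
  Iter-snoc (it-suc r it@(it-suc _ _)) = let (z , it′ , r′) = Iter-snoc it in z , it-suc r it′ , r′

  Iter-+ : ∀ m {n s y} → Iter R (m + n) s y → ∃ λ z → Iter R m s z × Iter R n z y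
  Iter-+ zero it = _ , it-zero , it
  Iter-+ (suc m) (it-suc r it) = let (z , it₁ , it₂) = Iter-+ m it in z , it-suc r it₁ , it₂

  Iter-suc : (∀ {z w} → R z w → w ≡ suc z) → ∀ {n s y} → Iter R n s y → y ≡ n + s
  Iter-suc _ it-zero = refl
  Iter-suc R≡suc {suc n} {s} (it-suc r it) rewrite R≡suc r = trans (Iter-suc R≡suc it) (+-suc n s)

  Iter-inflationary : Inflationary R → ∀ {n} → Inflationary (Iter R n)
  Iter-inflationary _ it-zero = ≤-refl
  Iter-inflationary infl (it-suc r it) = ≤-trans (infl r) (Iter-inflationary infl it)

  Iter-grows : Doubling R → ∀ {n s y} → 1 ≤ s → Iter R n s y → n + s ≤ y
  Iter-grows _ _ it-zero = ≤-refl
  Iter-grows dbl {suc n} {s} 1≤s (it-suc {z = z} r it) = begin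
    suc n + s  ≡⟨ sym (+-suc n s) ⟩
    n + suc s  ≤⟨ +-monoʳ-≤ n 1+s≤z ⟩
    n + z      ≤⟨ Iter-grows dbl (≤-trans 1≤s (≤-trans (n≤1+n s) 1+s≤z)) it ⟩
    _          ∎
    where
    open ≤-Reasoning
    1+s≤z : suc s ≤ z
    1+s≤z = ≤-trans (+-monoˡ-≤ s 1≤s) (≤-trans (≤-reflexive (cong (s +_) (sym (+-identityʳ s)))) (dbl r))

  Iter-doubling : Doubling R → ∀ {n s y} → Iter R n s y → 2 ^ n * s ≤ y
  Iter-doubling _ {s = s} it-zero = ≤-reflexive (*-identityˡ s)
  Iter-doubling dbl {suc n} {s} (it-suc {z = z} r it) = begin
    2 * 2 ^ n * s    ≡⟨ cong (_* s) (*-comm 2 (2 ^ n)) ⟩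
    2 ^ n * 2 * s    ≡⟨ *-assoc (2 ^ n) 2 s ⟩
    2 ^ n * (2 * s)  ≤⟨ *-monoʳ-≤ (2 ^ n) (dbl r) ⟩
    2 ^ n * z        ≤⟨ Iter-doubling dbl it ⟩
    _                ∎
    where open ≤-Reasoning

  Iter-last-≥ : Doubling R → ∀ {n y} → Iter R (suc n) 1 y → ∃ λ z → suc n ≤ z × R z y
  Iter-last-≥ dbl {n} it =
    let (z , it′ , r) = Iter-snoc it in z , subst (_≤ z) (+-comm n 1) (Iter-grows dbl ≤-refl it′) , r

  Iter-from-1-doubling : Doubling R → ∀ {n y} → Iter R n 1 y → 2 * n ≤ y
  Iter-from-1-doubling _ it-zero = z≤n
  Iter-from-1-doubling dbl {suc n} it =
    let (z , 1+n≤z , r) = Iter-last-≥ dbl it in ≤-trans (*-monoʳ-≤ 2 1+n≤z) (dbl r)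

Iter-mono : ∀ {R S : ℕ → ℕ → Set} → R ≤ᵍ S → Inflationary S → ∀ {n m} → n ≤ m → Iter R n ≤ᵍ Iter S m
Iter-mono _ S-infl z≤n s≤s′ it-zero it′ = ≤-trans s≤s′ (Iter-inflationary S-infl it′)
Iter-mono R≤S S-infl (s≤s n≤m) s≤s′ (it-suc r it) (it-suc r′ it′) =
  Iter-mono R≤S S-infl n≤m (R≤S s≤s′ r r′) it it′

6s+5≤16s : ∀ s → 1 ≤ s → 6 * s + 5 ≤ 16 * s
6s+5≤16s (suc t) _ =
  subst (6 * suc t + 5 ≤_) (sym (16[1+t]≡6[1+t]+5+[10t+5] t)) (m≤m+n (6 * suc t + 5) (10 * t + 5))
  where
  16[1+t]≡6[1+t]+5+[10t+5] : ∀ t → 16 * suc t ≡ 6 * suc t + 5 + (10 * t + 5)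
  16[1+t]≡6[1+t]+5+[10t+5] = solve-∀

x+5[1+j]≡x+5j+5 : ∀ x j → x + 5 * suc j ≡ x + 5 * j + 5
x+5[1+j]≡x+5j+5 = solve-∀

6x+5≡x+5[1+x] : ∀ x → 6 * x + 5 ≡ x + 5 * suc x
6x+5≡x+5[1+x] = solve-∀

module _ {R S : ℕ → ℕ → Set}
  (S-total : ∀ z → ∃ (S z)) (S-mono : S ≤ᵍ S) (S-doubling : Doubling S)
  (R≤S[6z+5] : ∀ {z u w} → R z u → S (6 * z + 5) w → u ≤ w)
  where

  -- Invariant: R^j(x) ≤ S^(x+5j)(1); each further R-step is paid for by five S-steps,
  -- four of which lift the argument w to at least 16w ≥ 6w+5.
  Iter-≤-Iter-from-1 : ∀ x j {u w} → Iter R j x u → Iter S (x + 5 * j) 1 w → u ≤ w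
  Iter-≤-Iter-from-1 x zero it-zero itS =
    ≤-trans (m≤m+n x 0) (≤-trans (m≤m+n (x + 0) 1) (Iter-grows S-doubling ≤-refl itS))
  Iter-≤-Iter-from-1 x (suc j) {w = w} itR itS =
    let (u′ , itR′ , Ru) = Iter-snoc itR
        (w′ , itS′ , itS₅) = Iter-+ (x + 5 * j) (subst (λ n → Iter S n 1 w) (x+5[1+j]≡x+5j+5 x j) itS)
        (w₄ , itS₄ , Sw) = Iter-snoc itS₅
        (v , Sv) = S-total (6 * u′ + 5)
        1≤w′ : 1 ≤ w′
        1≤w′ = ≤-trans (m≤n+m 1 (x + 5 * j)) (Iter-grows S-doubling ≤-refl itS′)
        6u′+5≤w₄ : 6 * u′ + 5 ≤ w₄
        6u′+5≤w₄ = ≤-trans (+-monoˡ-≤ 5 (*-monoʳ-≤ 6 (Iter-≤-Iter-from-1 x j itR′ itS′)))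
                     (≤-trans (6s+5≤16s w′ 1≤w′) (Iter-doubling S-doubling itS₄))
    in ≤-trans (R≤S[6z+5] Ru Sv) (S-mono 6u′+5≤w₄ Sv Sw)

  Iter-1+x-≤-Iter-6x+5 : ∀ x {u w} → Iter R (suc x) x u → Iter S (6 * x + 5) 1 w → u ≤ w
  Iter-1+x-≤-Iter-6x+5 x {w = w} itR itS =
    Iter-≤-Iter-from-1 x (suc x) itR (subst (λ n → Iter S n 1 w) (6x+5≡x+5[1+x] x) itS)

-- The two hierarchies

⇝*-Monotone : (Ord → ℕ → ℕ → Set) → Ord → Set
⇝*-Monotone H α = ∀ {β} → α ⇝* β → H β ≤ᵍ H α

-- At a limit λ, x ≤ y gives λ[y] ⇝* λ[x], so both sides can be compared inside H (λ[y]).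
limit-⇝*-monotone : ∀ {H : Ord → ℕ → ℕ → Set} → (∀ {α x y} → IsLimit α → H α x y → H (α [ x ]) x y) →
  ∀ {α} → IsNF α → IsLimit α → (∀ x → ⇝*-Monotone H (α [ x ])) → ⇝*-Monotone H α
limit-⇝*-monotone H-lim⁻¹ nα l ih ε {x} {y} x≤y u v =
  ih y (fs-⇝* nα l x≤y) x≤y (H-lim⁻¹ l u) (H-lim⁻¹ l v)
limit-⇝*-monotone H-lim⁻¹ nα l ih (fs-step _ ◅ r) {y = y} x≤y u v =
  ih y (fs-⇝* nα l z≤n ◅◅ r) x≤y u (H-lim⁻¹ l v)
limit-⇝*-monotone _ _ l _ (pred-step s ◅ _) = ⊥-elim (succ⇒¬limit s l)

F-𝟎⁻¹ : ∀ {x y} → F 𝟎 x y → y ≡ suc x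
F-𝟎⁻¹ F-zero = refl
F-𝟎⁻¹ (F-suc () _)
F-𝟎⁻¹ (F-lim l _) = ⊥-elim (proj₁ l refl)

F-suc⁻¹ : ∀ {α x y} → isSucc α ≡ true → F α x y → Iter (F (pred α)) (suc x) x y
F-suc⁻¹ () F-zero
F-suc⁻¹ _ (F-suc _ it) = it
F-suc⁻¹ s (F-lim l _) = ⊥-elim (succ⇒¬limit s l)

F-lim⁻¹ : ∀ {α x y} → IsLimit α → F α x y → F (α [ x ]) x y
F-lim⁻¹ l F-zero = ⊥-elim (proj₁ l refl)
F-lim⁻¹ l (F-suc s _) = ⊥-elim (succ⇒¬limit s l)
F-lim⁻¹ _ (F-lim _ d) = d

F-𝟏 : ∀ {x y} → F 𝟏 x y → y ≡ suc x + x
F-𝟏 d = Iter-suc F-𝟎⁻¹ (F-suc⁻¹ refl d)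

mutual
  F-inflationary : ∀ {α x y} → F α x y → x < y
  F-inflationary F-zero = ≤-refl
  F-inflationary (F-suc _ (it-suc r it)) = <-≤-trans (F-inflationary r) (F-iter-inflationary it)
  F-inflationary (F-lim _ d) = F-inflationary d

  F-iter-inflationary : ∀ {β n s y} → Iter (F β) n s y → s ≤ y
  F-iter-inflationary it-zero = ≤-refl
  F-iter-inflationary (it-suc r it) = ≤-trans (<⇒≤ (F-inflationary r)) (F-iter-inflationary it)

F-total : ∀ {α} → IsNF α → ∀ x → ∃ (F α x)
F-total = nf-rec {P = λ α → ∀ x → ∃ (F α x)}
  (λ x → suc x , F-zero)
  (λ _ s ih x → map₂ (F-suc s) (Iter-total ih (suc x) x))
  (λ _ l ih x → map₂ (F-lim l) (ih x x))

F-mono-⇝* : ∀ {α} → IsNF α → ⇝*-Monotone F α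
F-mono-⇝* = nf-rec {P = ⇝*-Monotone F} zero-case succ-case (limit-⇝*-monotone F-lim⁻¹)
  where
  zero-case : ⇝*-Monotone F 𝟎
  zero-case ε x≤y u v rewrite F-𝟎⁻¹ u | F-𝟎⁻¹ v = s≤s x≤y
  zero-case (pred-step () ◅ _)
  zero-case (fs-step l ◅ _) = ⊥-elim (proj₁ l refl)

  succ-case : ∀ {α} → IsNF α → isSucc α ≡ true → ⇝*-Monotone F (pred α) → ⇝*-Monotone F α
  succ-case _ s ih ε x≤y u v =
    Iter-mono (ih ε) (λ r → <⇒≤ (F-inflationary r)) (s≤s x≤y) x≤y (F-suc⁻¹ s u) (F-suc⁻¹ s v)
  succ-case _ s ih (pred-step _ ◅ r) x≤y u v with F-suc⁻¹ s v
  ... | it-suc v₁ it = ≤-trans (ih r x≤y u v₁) (F-iter-inflationary it)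
  succ-case _ s _ (fs-step l ◅ _) = ⊥-elim (succ⇒¬limit s l)

¬A-𝟎 : ∀ {x y} → ¬ A 𝟎 x y
¬A-𝟎 (A-suc () _ _)
¬A-𝟎 (A-lim l _) = proj₁ l refl

A-𝟏⁻¹ : ∀ {x y} → A 𝟏 x y → y ≡ 2 * x
A-𝟏⁻¹ A-one = refl
A-𝟏⁻¹ (A-suc _ p≢𝟎 _) = ⊥-elim (p≢𝟎 refl)
A-𝟏⁻¹ (A-lim l _) = ⊥-elim (succ⇒¬limit refl l)

A-suc⁻¹ : ∀ {α x y} → isSucc α ≡ true → pred α ≢ 𝟎 → A α x y → Iter (A (pred α)) x 1 y
A-suc⁻¹ _ p≢𝟎 A-one = ⊥-elim (p≢𝟎 refl)
A-suc⁻¹ _ _ (A-suc _ _ it) = it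
A-suc⁻¹ s _ (A-lim l _) = ⊥-elim (succ⇒¬limit s l)

A-lim⁻¹ : ∀ {α x y} → IsLimit α → A α x y → A (α [ x ]) x y
A-lim⁻¹ l A-one = ⊥-elim (succ⇒¬limit refl l)
A-lim⁻¹ l (A-suc s _ _) = ⊥-elim (succ⇒¬limit s l)
A-lim⁻¹ _ (A-lim _ d) = d

A-at-0 : ∀ {α y} → A α 0 y → y ≤ 1
A-at-0 A-one = z≤n
A-at-0 (A-suc _ _ it-zero) = ≤-refl
A-at-0 (A-lim _ d) = A-at-0 d

A-total : ∀ {α} → IsNF α → α ≢ 𝟎 → ∀ x → ∃ (A α x)
A-total = nf-rec⁺ {P = λ α → ∀ x → ∃ (A α x)}
  (λ x → 2 * x , A-one)
  (λ _ s p≢𝟎 ih x → map₂ (A-suc s p≢𝟎) (Iter-total ih x 1))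
  (λ _ l ih x → map₂ (A-lim l) (ih x x))

A-doubling : ∀ {α} → IsNF α → α ≢ 𝟎 → Doubling (A α)
A-doubling = nf-rec⁺ {P = λ α → Doubling (A α)}
  (λ a → ≤-reflexive (sym (A-𝟏⁻¹ a)))
  (λ _ s p≢𝟎 ih a → Iter-from-1-doubling ih (A-suc⁻¹ s p≢𝟎 a))
  (λ _ l ih {z} a → ih z (A-lim⁻¹ l a))

A-inflationary : ∀ {α} → IsNF α → α ≢ 𝟎 → Inflationary (A α)
A-inflationary nα α≢𝟎 {z} a = ≤-trans (m≤m+n z (z + 0)) (A-doubling nα α≢𝟎 a)

A-mono-⇝* : ∀ {α} → IsNF α → α ≢ 𝟎 → ⇝*-Monotone A α
A-mono-⇝* = nf-rec⁺ {P = ⇝*-Monotone A} one-case succ-case (limit-⇝*-monotone A-lim⁻¹)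
  where
  one-case : ⇝*-Monotone A 𝟏
  one-case ε x≤y u v rewrite A-𝟏⁻¹ u | A-𝟏⁻¹ v = *-monoʳ-≤ 2 x≤y
  one-case (pred-step _ ◅ r) _ u _ with 𝟎-⇝* r
  ... | refl = ⊥-elim (¬A-𝟎 u)
  one-case (fs-step l ◅ _) = ⊥-elim (succ⇒¬limit refl l)

  succ-case : ∀ {α} → IsNF α → isSucc α ≡ true → pred α ≢ 𝟎 → ⇝*-Monotone A (pred α) → ⇝*-Monotone A α
  succ-case nα s p≢𝟎 ih ε x≤y u v =
    Iter-mono (ih ε) (A-inflationary (pred-nf nα) p≢𝟎) x≤y ≤-refl (A-suc⁻¹ s p≢𝟎 u) (A-suc⁻¹ s p≢𝟎 v)
  succ-case _ s p≢𝟎 _ (pred-step _ ◅ _) {y = zero} z≤n u v with A-suc⁻¹ s p≢𝟎 v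
  ... | it-zero = A-at-0 u
  succ-case nα s p≢𝟎 ih (pred-step _ ◅ r) {y = suc _} x≤y u v =
    let (z , y≤z , Az) = Iter-last-≥ (A-doubling (pred-nf nα) p≢𝟎) (A-suc⁻¹ s p≢𝟎 v)
    in ih r (≤-trans x≤y y≤z) u Az
  succ-case _ s _ _ (fs-step l ◅ _) = ⊥-elim (succ⇒¬limit s l)

A-mono : ∀ {α} → IsNF α → α ≢ 𝟎 → A α ≤ᵍ A α
A-mono nα α≢𝟎 = A-mono-⇝* nα α≢𝟎 ε

A≤F : ∀ {α} → IsNF α → α ≢ 𝟎 → A α ≤ᵍ F α
A≤F = nf-rec⁺ {P = λ α → A α ≤ᵍ F α} one-case succ-case limit-case
  where
  one-case : A 𝟏 ≤ᵍ F 𝟏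
  one-case {y = y} x≤y u v rewrite A-𝟏⁻¹ u | F-𝟏 v =
    m≤n⇒m≤1+n (≤-trans (*-monoʳ-≤ 2 x≤y) (≤-reflexive (cong (y +_) (+-identityʳ y))))

  succ-case : ∀ {α} → IsNF α → isSucc α ≡ true → pred α ≢ 𝟎 → A (pred α) ≤ᵍ F (pred α) → A α ≤ᵍ F α
  succ-case _ s p≢𝟎 ih x≤y u v with F-suc⁻¹ s v
  ... | it-suc v₁ it =
    Iter-mono ih (λ r → <⇒≤ (F-inflationary r)) x≤y (<-≤-trans (s≤s z≤n) (F-inflationary v₁))
      (A-suc⁻¹ s p≢𝟎 u) it

  limit-case : ∀ {α} → IsNF α → IsLimit α → (∀ x → A (α [ x ]) ≤ᵍ F (α [ x ])) → A α ≤ᵍ F α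
  limit-case nα l ih {x} {y} x≤y u v =
    ≤ᵍ-trans (F-total (fs-nf x nα l)) (ih x) (F-mono-⇝* (fs-nf y nα l) (fs-⇝* nα l x≤y))
      x≤y (A-lim⁻¹ l u) (F-lim⁻¹ l v)

F≤A[6x+5]-at : Ord → Set
F≤A[6x+5]-at α = ∀ {x u w} → F α x u → A α (6 * x + 5) w → u ≤ w

F≤A[6x+5] : ∀ {α} → IsNF α → α ≢ 𝟎 → F≤A[6x+5]-at α
F≤A[6x+5] = nf-rec⁺ {P = F≤A[6x+5]-at} one-case succ-case limit-case
  where
  one-case : F≤A[6x+5]-at 𝟏
  one-case {x} u w rewrite F-𝟏 u | A-𝟏⁻¹ w =
    subst (suc x + x ≤_) (sym (2[6x+5]≡1+x+x+[10x+9] x)) (m≤m+n (suc x + x) (10 * x + 9))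
    where
    2[6x+5]≡1+x+x+[10x+9] : ∀ x → 2 * (6 * x + 5) ≡ suc x + x + (10 * x + 9)
    2[6x+5]≡1+x+x+[10x+9] = solve-∀

  succ-case : ∀ {α} → IsNF α → isSucc α ≡ true → pred α ≢ 𝟎 → F≤A[6x+5]-at (pred α) → F≤A[6x+5]-at α
  succ-case nα s p≢𝟎 ih {x} u w =
    Iter-1+x-≤-Iter-6x+5 (A-total np p≢𝟎) (A-mono np p≢𝟎) (A-doubling np p≢𝟎) ih
      x (F-suc⁻¹ s u) (A-suc⁻¹ s p≢𝟎 w)
    where np = pred-nf nα

  limit-case : ∀ {α} → IsNF α → IsLimit α → (∀ x → F≤A[6x+5]-at (α [ x ])) → F≤A[6x+5]-at α
  limit-case nα l ih {x} u w =
    let (_ , A[x]) = A-total (fs-nf x nα l) (fs-≢𝟎 x l) (6 * x + 5)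
        x≤6x+5 = ≤-trans (m≤n*m x 6) (m≤m+n (6 * x) 5)
    in ≤-trans (ih x (F-lim⁻¹ l u) A[x])
         (A-mono-⇝* (fs-nf (6 * x + 5) nα l) (fs-≢𝟎 (6 * x + 5) l) (fs-⇝* nα l x≤6x+5)
            ≤-refl A[x] (A-lim⁻¹ l w))

lemmaA3 : (α : Ord) → IsNF α → α ≢ 𝟎 → (x : ℕ) →
    Σ ℕ λ a → Σ ℕ λ f → Σ ℕ λ b →
    A α x a × F α x f × A α (6 * x + 5) b × a ≤ f × f ≤ b
lemmaA3 α nα α≢𝟎 x =
  let (a , Aa) = A-total nα α≢𝟎 x
      (f , Ff) = F-total nα x
      (b , Ab) = A-total nα α≢𝟎 (6 * x + 5)
  in a , f , b , Aa , Ff , Ab , A≤F nα α≢𝟎 ≤-refl Aa Ff , F≤A[6x+5] nα α≢𝟎 Ff Ab
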